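{- Let $\Phi=(\Lambda\colon G\to R\langle\langle X\rangle\rangle^{\times,1},\tau\colon L\to G,e)$ be a Magnus formation over a profinite commutative ring $R$, and for $w'\in L$ put $\sigma_{w'}=\tau(w')^{e(|w'|)}$. Let $w\in X^*$ and $w'\in L$ have lengths $i$ and $i'$. Then: (a) if $1\neq w\prec w'$, then $\varepsilon_w(\sigma_{w'})=0$; (b) if $w=w'$, then $\varepsilon_w(\sigma_{w'})=e(i)1_R$; (c) if $1\leq i\leq n$, then $\varepsilon_w(\sigma_{w'})\in e(i)R$; (d) if $w$ contains a letter not appearing in $w'$, then $\varepsilon_w(\sigma_{w'})=0$.
   Context: Fix an integer $n\geq2$ and a nonempty totally ordered set $X$. $X^*$ is the free monoid of words (empty word $1$), $|w|$ the length, $\leq_{\mathrm{alp}}$ lexicographic order, and $\preceq$ the length-alphabetical order: $w_1\preceq w_2$ iff $|w_1|<|w_2|$, or $|w_1|=|w_2|$ and $w_1\leq_{\mathrm{alp}}w_2$ ($\prec$ its strict version). $R\langle\langle X\rangle\rangle$ is the ring of formal power series in noncommuting variables $X$ over $R$ with the coarsest topology making coefficient maps continuous; $R\langle\langle X\rangle\rangle^{\times,1}$ is its group of invertible series with constant term $1$; $\varepsilon_w(\sigma)$ is the coefficient of $w$ in $\Lambda(\sigma)$. For $w\in X^*$, $o(w)$ denotes any series whose support consists of words strictly $\preceq$-larger than $w$ made of letters occurring in $w$. $G^{(i)}$ is the closed lower central series ($G^{(1)}=G$, $G^{(i+1)}=[G,G^{(i)}]$). A map $e\colon\{1,\dots,n\}\to\mathbb{Z}_{\geq1}$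 is binomial if $e(i)\mid\binom{e(i')}{l}$ whenever $i'l\leq i\leq n$ and $1\leq l\leq e(i')$. A Magnus formation over $R$ is a triple $(\Lambda,\tau,e)$ with $G$ a profinite group, $\Lambda$ a continuous group homomorphism, $L$ a nonempty subset of $X^*$ of words with lengths in $\{1,\dots,n\}$, $\tau\colon L\to G$ a map with $\tau(w)\in G^{(|w|)}$ and $\Lambda(\tau(w))=1+w+o(w)$ for all $w\in L$, and $e$ binomial and not identically $1$. -}

module Defs where

open import Level using (Level; _⊔_; Lift) renaming (suc to lsuc)
open import Data.Nat as ℕ using (ℕ; zero; suc; _≤_; _<_)
open import Data.Nat.Divisibility using (_∣_)
open import Data.Nat.Combinatorics using (_C_)
open import Data.List using (List; []; _∷_; _++_; length; foldr; map)
open import Data.List.Membership.Propositional using (_∈_; _∉_)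
open import Data.List.Relation.Unary.All using (All)
open import Data.List.Relation.Unary.Any using (Any)
open import Data.Product using (Σ; _×_; _,_; ∃; proj₁; proj₂)
open import Data.Sum using (_⊎_)
open import Data.Unit.Polymorphic using (⊤)
open import Data.Empty using (⊥)
open import Relation.Nullary using (¬_)
open import Relation.Binary.PropositionalEquality using (_≡_)
open import Relation.Binary.Structures using (IsStrictTotalOrder)
open import Algebra.Bundles using (CommutativeRing; Group)

record Topology {ℓ} (A : Set ℓ) : Set (lsuc ℓ) where
  field
    IsOpen   : (A → Set ℓ) → Set ℓ
    whole    : IsOpen (λ _ → ⊤)
    inter    : ∀ U V → IsOpen U → IsOpen V → IsOpen (λ x → U x × V x)
    union    : (I : Set ℓ) (U : I → A → Set ℓ) → (∀ i → IsOpen (U i)) →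
               IsOpen (λ x → Σ I (λ i → U i x))

module _ {ℓ} {A : Set ℓ} (T : Topology A) where
  open Topology T

  IsClosed : (A → Set ℓ) → Set ℓ
  IsClosed C = IsOpen (λ x → ¬ C x)

  IsCompact : Set (lsuc ℓ)
  IsCompact = (I : Set ℓ) (U : I → A → Set ℓ) → (∀ i → IsOpen (U i)) →
              (∀ x → Σ I (λ i → U i x)) →
              Σ (List I) (λ is → ∀ x → Any (λ i → U i x) is)

  Closure : ∀ {k} → (A → Set k) → A → Set (lsuc ℓ ⊔ k)
  Closure S x = (U : A → Set ℓ) → IsOpen U → U x → Σ A (λ y → U y × S y)

record IsProfiniteSpace {ℓ} {A : Set ℓ} (_≈_ : A → A → Set ℓ)
                        (T : Topology A) : Set (lsuc ℓ) where
  open Topology T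
  field
    opens-respect : ∀ U → IsOpen U → ∀ {x y} → x ≈ y → U x → U y
    compact       : IsCompact T
    hausdorff     : ∀ x y → ¬ (x ≈ y) →
                    Σ (A → Set ℓ) λ U → Σ (A → Set ℓ) λ V →
                    IsOpen U × IsOpen V × U x × V y ×
                    (∀ z → U z → V z → Lift ℓ ⊥)
    totally-disconnected : ∀ x y → ¬ (x ≈ y) →
                    Σ (A → Set ℓ) λ U → IsOpen U × IsClosed T U × U x × ¬ U y

module _ {ℓ} {A B : Set ℓ} (TA : Topology A) (TB : Topology B) where
  Continuous : (A → B) → Set (lsuc ℓ)
  Continuous f = ∀ U → Topology.IsOpen TB U → Topology.IsOpen TA (λ x → U (f x))

module _ {ℓ} {A : Set ℓ} (T : Topology A) where
  open Topology T
  -- continuity of a binary operation A × A → A (product topology)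
  Continuous₂ : (A → A → A) → Set (lsuc ℓ)
  Continuous₂ f = ∀ U → IsOpen U → ∀ x y → U (f x y) →
    Σ (A → Set ℓ) λ V → Σ (A → Set ℓ) λ W →
    IsOpen V × IsOpen W × V x × W y × (∀ x' y' → V x' → W y' → U (f x' y'))

record IsProfiniteGroup {ℓ} (G : Group ℓ ℓ) (T : Topology (Group.Carrier G))
                        : Set (lsuc ℓ) where
  open Group G
  field
    profinite : IsProfiniteSpace _≈_ T
    mul-cont  : Continuous₂ T _∙_
    inv-cont  : Continuous T T _⁻¹

record IsProfiniteRing {ℓ} (R : CommutativeRing ℓ ℓ)
                       (T : Topology (CommutativeRing.Carrier R)) : Set (lsuc ℓ) where
  open CommutativeRing R
  field
    profinite : IsProfiniteSpace _≈_ T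
    add-cont  : Continuous₂ T _+_
    mul-cont  : Continuous₂ T _*_
    neg-cont  : Continuous T T (-_)

module LCS {ℓ} (G : Group ℓ ℓ) (T : Topology (Group.Carrier G)) where
  open Group G

  commutator : Carrier → Carrier → Carrier
  commutator g h = ((g ⁻¹) ∙ (h ⁻¹)) ∙ (g ∙ h)

  data Gen {k} (S : Carrier → Set k) : Carrier → Set (ℓ ⊔ k) where
    gen  : ∀ {x} → S x → Gen S x
    one  : Gen S ε
    mul  : ∀ {x y} → Gen S x → Gen S y → Gen S (x ∙ y)
    inv  : ∀ {x} → Gen S x → Gen S (x ⁻¹)
    resp : ∀ {x y} → x ≈ y → Gen S x → Gen S y

  -- G^(1) = G, G^(i+1) = closure of [G, G^(i)]
  lcs : ℕ → Carrier → Set (lsuc ℓ)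
  lcs zero    _ = ⊤
  lcs (suc zero) _ = ⊤
  lcs (suc (suc i)) = Closure T
    (Gen (λ x → Σ Carrier λ g → Σ Carrier λ h →
                 lcs (suc i) h × (x ≈ commutator g h)))

module Words {ℓ} {X : Set ℓ} (_<ₓ_ : X → X → Set ℓ) where

  Word : Set ℓ
  Word = List X

  _<alp_ : Word → Word → Set ℓ
  w₁ <alp w₂ = Σ Word λ u → Σ X λ a → Σ X λ b → Σ Word λ v₁ → Σ Word λ v₂ →
               (a <ₓ b) × (w₁ ≡ u ++ (a ∷ v₁)) × (w₂ ≡ u ++ (b ∷ v₂))

  _≺_ : Word → Word → Set ℓ
  w₁ ≺ w₂ = Lift ℓ (length w₁ < length w₂) ⊎
            (Lift ℓ (length w₁ ≡ length w₂) × (w₁ <alp w₂))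

-- Noncommutative formal power series R⟨⟨X⟩⟩ as coefficient functions

module Series {ℓ} (R : CommutativeRing ℓ ℓ) (X : Set ℓ) where
  open CommutativeRing R

  Ser : Set ℓ
  Ser = List X → Carrier

  _≈ₛ_ : Ser → Ser → Set ℓ
  s ≈ₛ t = ∀ w → s w ≈ t w

  splits : List X → List (List X × List X)
  splits []       = ([] , []) ∷ []
  splits (x ∷ w)  = ([] , x ∷ w) ∷ map (λ p → (x ∷ proj₁ p , proj₂ p)) (splits w)

  sumR : List Carrier → Carrier
  sumR = foldr _+_ 0#

  _·_ : Ser → Ser → Ser
  (s · t) w = sumR (map (λ p → s (proj₁ p) * t (proj₂ p)) (splits w))

  natMul : ℕ → Carrier → Carrier
  natMul zero    r = 0#
  natMul (suc k) r = r + natMul k r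

module GPow {ℓ} (G : Group ℓ ℓ) where
  open Group G
  gpow : Carrier → ℕ → Carrier
  gpow g zero    = ε
  gpow g (suc k) = g ∙ gpow g k

-- Binomial maps e : {1,…,n} → ℤ≥1 (encoded as ℕ → ℕ; only values on
-- 1..n matter)

IsBinomial : ℕ → (ℕ → ℕ) → Set
IsBinomial n e = ∀ i i' l → 1 ≤ i' → i' ℕ.* l ≤ i → i ≤ n → 1 ≤ l → l ≤ e i' →
                 e i ∣ (e i' C l)

record MagnusFormation {ℓ} (n : ℕ)
    (X : Set ℓ) (_<ₓ_ : X → X → Set ℓ)
    (R : CommutativeRing ℓ ℓ) (TR : Topology (CommutativeRing.Carrier R))
    (G : Group ℓ ℓ) (TG : Topology (Group.Carrier G)) : Set (lsuc ℓ) where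
  open CommutativeRing R using (_≈_; 0#; 1#) renaming (Carrier to R₀)
  open Group G using (_∙_) renaming (Carrier to G₀; _≈_ to _≈G_; ε to εG)
  open Series R X
  open Words _<ₓ_
  open LCS G TG using (lcs)
  field
    Λ            : G₀ → Ser
    Λ-const      : ∀ g → Λ g [] ≈ 1#
    Λ-resp       : ∀ {g h} → g ≈G h → Λ g ≈ₛ Λ h
    Λ-hom        : ∀ g h → Λ (g ∙ h) ≈ₛ (Λ g · Λ h)
    Λ-cont       : ∀ w → Continuous TG TR (λ g → Λ g w)
    L            : Word → Set ℓ
    L-nonempty   : Σ Word L
    L-len        : ∀ w → L w → 1 ≤ length w × length w ≤ n
    τ            : (w : Word) → L w → G₀
    τ-lcs        : ∀ w (p : L w) → lcs (length w) (τ w p)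
    -- Λ(τ(w)) = 1 + w + o(w)
    τ-const      : ∀ w (p : L w) → Λ (τ w p) [] ≈ 1#
    τ-lead       : ∀ w (p : L w) → Λ (τ w p) w ≈ 1#
    τ-rest       : ∀ w (p : L w) (v : Word) → ¬ (v ≡ []) → ¬ (v ≡ w) →
                   ¬ ((w ≺ v) × All (λ x → x ∈ w) v) → Λ (τ w p) v ≈ 0#
    e            : ℕ → ℕ
    e-pos        : ∀ i → 1 ≤ i → i ≤ n → 1 ≤ e i
    e-binomial   : IsBinomial n e
    e-nontrivial : Σ ℕ λ i → 1 ≤ i × i ≤ n × ¬ (e i ≡ 1)

module _ {ℓ} {n : ℕ} {X : Set ℓ} {_<ₓ_ : X → X → Set ℓ}
         {R : CommutativeRing ℓ ℓ} {TR : Topology (CommutativeRing.Carrier R)}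
         {G : Group ℓ ℓ} {TG : Topology (Group.Carrier G)}
         (Φ : MagnusFormation n X _<ₓ_ R TR G TG) where
  open MagnusFormation Φ

  εcoef : List X → Group.Carrier G → CommutativeRing.Carrier R
  εcoef w g = Λ g w

  σ : (w' : List X) → L w' → Group.Carrier G
  σ w' p = GPow.gpow G (τ w' p) (e (length w'))

{-# OPTIONS --safe #-}
-- Write T = Λ(τ(w')) = 1 + S, where S has no constant term and, since
-- Λ(τ(w')) = 1 + w' + o(w'), vanishes on nonempty words shorter than w' and
-- on words containing a letter foreign to w'. As Λ is a homomorphism,
-- Λ(σ_{w'}) = (1 + S)^e = Σ_j C(e, j) S^j with e = e(|w'|). The series S^j
-- vanishes on words of length < j|w'|, so on words no longer than w' only the
-- term e·S survives, giving (a) and (b); on a word of length i ≤ n every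
-- surviving term has j|w'| ≤ i, and binomiality of e makes C(e, j) a multiple
-- of e(i), giving (c). Part (d) holds because T, and hence every power of T,
-- vanishes on words with a foreign letter.
module Submission where

open import Defs
open import Level using (Level; lift)
open import Function using (_∘_; id)
open import Data.Nat as ℕ using (ℕ; zero; suc; _≤_; _<_; z≤n; s≤s)
import Data.Nat.Properties as ℕ
open import Data.Nat.Divisibility using (_∣_; divides)
open import Data.Nat.Combinatorics using (_C_; nC1≡n; k>n⇒nCk≡0; nCk+nC[k+1]≡[n+1]C[k+1])
open import Data.Fin as Fin using (Fin; toℕ)
open import Data.Fin.Properties using (toℕ≤pred[n])
open import Data.Vec.Functional using (Vector)
open import Data.List using (List; []; _∷_; _++_; length; map)
open import Data.List.Properties using (length-++; map-∘; ∷-injectiveʳ)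
open import Data.List.Membership.Propositional using (_∉_)
open import Data.List.Relation.Unary.Any using (Any)
open import Data.List.Relation.Unary.Any.Properties using (++⁻)
import Data.List.Relation.Unary.All as All
open import Data.List.Relation.Unary.All.Properties using (Any¬⇒¬All)
open import Data.Product using (Σ; _,_; proj₁; proj₂; map₂)
open import Data.Sum using (_⊎_; inj₁; inj₂)
open import Data.Empty using (⊥; ⊥-elim)
open import Relation.Nullary using (¬_; yes; no)
open import Relation.Binary.PropositionalEquality as ≡ using (_≡_; _≢_)
open import Relation.Binary.Structures using (IsStrictTotalOrder)
open import Algebra.Bundles using (Semiring; CommutativeRing; Group)

module LengthAlphabetical {ℓ} {X : Set ℓ} {_<ₓ_ : X → X → Set ℓ}
                          (<ₓ-sto : IsStrictTotalOrder _≡_ _<ₓ_) where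
  open Words _<ₓ_
  open IsStrictTotalOrder <ₓ-sto using (irrefl; asym)

  first-differences-disagree : ∀ u u' {a b c d v₁ v₂ v₃ v₄} →
    u ++ a ∷ v₁ ≡ u' ++ d ∷ v₄ → u ++ b ∷ v₂ ≡ u' ++ c ∷ v₃ →
    a <ₓ b → c <ₓ d → ⊥
  first-differences-disagree []      []       ≡.refl ≡.refl a<b c<d = asym a<b c<d
  first-differences-disagree []      (_ ∷ _)  ≡.refl ≡.refl a<b _   = irrefl ≡.refl a<b
  first-differences-disagree (_ ∷ _) []       ≡.refl ≡.refl _   c<d = irrefl ≡.refl c<d
  first-differences-disagree (_ ∷ u) (_ ∷ u') e₁ e₂ =
    first-differences-disagree u u' (∷-injectiveʳ e₁) (∷-injectiveʳ e₂)

  <alp-asym : ∀ {w₁ w₂} → w₁ <alp w₂ → w₂ <alp w₁ → ⊥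
  <alp-asym (u , _ , _ , _ , _ , a<b , e₁ , e₂) (u' , _ , _ , _ , _ , c<d , e₃ , e₄) =
    first-differences-disagree u u' (≡.trans (≡.sym e₁) e₄) (≡.trans (≡.sym e₂) e₃) a<b c<d

  ≺-asym : ∀ {w₁ w₂} → w₁ ≺ w₂ → w₂ ≺ w₁ → ⊥
  ≺-asym (inj₁ (lift l₁))     (inj₁ (lift l₂))     = ℕ.<-asym l₁ l₂
  ≺-asym (inj₁ (lift l₁))     (inj₂ (lift e , _))  = ℕ.<-irrefl (≡.sym e) l₁
  ≺-asym (inj₂ (lift e , _))  (inj₁ (lift l₂))     = ℕ.<-irrefl (≡.sym e) l₂
  ≺-asym (inj₂ (_ , lt₁))     (inj₂ (_ , lt₂))     = <alp-asym lt₁ lt₂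

  ≺-irrefl : ∀ {w} → ¬ w ≺ w
  ≺-irrefl w≺w = ≺-asym w≺w w≺w

  ≺⇒length≤ : ∀ {w₁ w₂} → w₁ ≺ w₂ → length w₁ ≤ length w₂
  ≺⇒length≤ (inj₁ (lift l))     = ℕ.<⇒≤ l
  ≺⇒length≤ (inj₂ (lift e , _)) = ℕ.≤-reflexive e

module BinomialSums {ℓ₁ ℓ₂} (S : Semiring ℓ₁ ℓ₂) where
  open Semiring S
  open import Algebra.Properties.Semiring.Mult S
    using (_×_; ×-congʳ; ×-congˡ; ×-homo-+; ×-assocˡ)
  open import Algebra.Properties.CommutativeMonoid.Mult +-commutativeMonoid
    using (×-distrib-+)
  open import Algebra.Properties.Semiring.Sum S
    using (sum; sum-syntax; sum⁺-syntax; sum-cong-≋; ∑-distrib-+; sum-replicate; sum-replicate-zero)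
  open import Algebra.Properties.CommutativeSemigroup +-commutativeSemigroup
    using (x∙yz≈xz∙y)
  open import Relation.Binary.Reasoning.Setoid setoid

  ×-zero : ∀ k → k × 0# ≈ 0#
  ×-zero k = trans (sym (sum-replicate k)) (sum-replicate-zero k)

  ×-distrib-sum : ∀ d {N} (t : Vector Carrier N) → d × sum t ≈ sum (λ j → d × t j)
  ×-distrib-sum d {zero}  t = ×-zero d
  ×-distrib-sum d {suc N} t = trans (×-distrib-+ _ _ d) (+-congˡ (×-distrib-sum d (t ∘ Fin.suc)))

  ∑-vanishes : ∀ {N} (t : Vector Carrier N) → (∀ j → t j ≈ 0#) → sum t ≈ 0#
  ∑-vanishes {N} t t≈0 = trans (sum-cong-≋ {x = t} {y = λ _ → 0#} t≈0) (sum-replicate-zero N)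

  ∑-multiple : ∀ d {N} (t : Vector Carrier N) → (∀ j → Σ Carrier λ r → t j ≈ d × r) →
               Σ Carrier λ r → sum t ≈ d × r
  ∑-multiple d t t≈d×r =
    sum r , trans (sum-cong-≋ {x = t} (proj₂ ∘ t≈d×r)) (sym (×-distrib-sum d r))
    where
    r : Vector Carrier _
    r = proj₁ ∘ t≈d×r

  ∑≤≈∑< : ∀ k (g : ℕ → Carrier) → g k ≈ 0# → ∑[ j ≤ k ] g (toℕ j) ≈ ∑[ j < k ] g (toℕ j)
  ∑≤≈∑< zero    g g0≈0   = trans (+-identityʳ _) g0≈0
  ∑≤≈∑< (suc k) g gk+1≈0 = +-congˡ (∑≤≈∑< k (g ∘ suc) gk+1≈0)

  binomialSum : ℕ → (ℕ → Carrier) → Carrier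
  binomialSum k f = ∑[ j ≤ k ] ((k C toℕ j) × f (toℕ j))

  binomialSum-pascal : ∀ k f →
    binomialSum (suc k) f ≈ binomialSum k f + binomialSum k (f ∘ suc)
  binomialSum-pascal k f = begin
    1 × f 0 + ∑[ j ≤ k ] ((suc k C suc (toℕ j)) × f (suc (toℕ j)))
      ≈⟨ +-congˡ (sum-cong-≋ {suc k} {y = λ j → a (toℕ j) + b (toℕ j)} λ j →
           trans (×-congˡ (≡.sym (nCk+nC[k+1]≡[n+1]C[k+1] k (toℕ j)))) (×-homo-+ _ (k C toℕ j) _)) ⟩
    1 × f 0 + ∑[ j ≤ k ] (a (toℕ j) + b (toℕ j))
      ≈⟨ +-congˡ (∑-distrib-+ {suc k} (a ∘ toℕ) (b ∘ toℕ)) ⟩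
    1 × f 0 + (∑[ j ≤ k ] a (toℕ j) + ∑[ j ≤ k ] b (toℕ j))
      ≈⟨ +-congˡ (+-congˡ (∑≤≈∑< k b (×-congˡ (k>n⇒nCk≡0 (ℕ.n<1+n k))))) ⟩
    1 × f 0 + (∑[ j ≤ k ] a (toℕ j) + ∑[ j < k ] b (toℕ j))
      ≈⟨ x∙yz≈xz∙y _ _ _ ⟩
    binomialSum k f + binomialSum k (f ∘ suc) ∎
    where
    a b : ℕ → Carrier
    a j = (k C j) × f (suc j)
    b j = (k C suc j) × f (suc j)

  binomialSum-at-1 : ∀ k f → f 0 ≈ 0# → (∀ j → f (2 ℕ.+ j) ≈ 0#) → binomialSum k f ≈ k × f 1
  binomialSum-at-1 zero    f f0≈0 _     = trans (+-identityʳ _) (trans (+-identityʳ _) f0≈0)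
  binomialSum-at-1 (suc k) f f0≈0 f2+≈0 = begin
    1 × f 0 + ((suc k C 1) × f 1 + ∑[ j < k ] c (toℕ j))
      ≈⟨ +-cong (trans (+-identityʳ _) f0≈0)
                (+-cong (×-congˡ (nC1≡n (suc k))) (∑-vanishes {k} (c ∘ toℕ) (c≈0 ∘ toℕ))) ⟩
    0# + (suc k × f 1 + 0#)
      ≈⟨ trans (+-identityˡ _) (+-identityʳ _) ⟩
    suc k × f 1 ∎
    where
    c : ℕ → Carrier
    c j = (suc k C (2 ℕ.+ j)) × f (2 ℕ.+ j)

    c≈0 : ∀ j → c j ≈ 0#
    c≈0 j = trans (×-congʳ (suc k C (2 ℕ.+ j)) (f2+≈0 j)) (×-zero (suc k C (2 ℕ.+ j)))

  binomialSum-multiple : ∀ d k f → (∀ j → j ≤ k → d ∣ k C j ⊎ f j ≈ 0#) →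
                         Σ Carrier λ r → binomialSum k f ≈ d × r
  binomialSum-multiple d k f d∣C⊎f≈0 =
    ∑-multiple d {suc k} (λ j → (k C toℕ j) × f (toℕ j))
      λ j → term (toℕ j) (d∣C⊎f≈0 _ (toℕ≤pred[n] j))
    where
    term : ∀ j → d ∣ k C j ⊎ f j ≈ 0# → Σ Carrier λ r → (k C j) × f j ≈ d × r
    term j (inj₁ (divides q C≡q*d)) =
      q × f j , trans (×-congˡ (≡.trans C≡q*d (ℕ.*-comm q d))) (sym (×-assocˡ (f j) d q))
    term j (inj₂ fj≈0) = 0# , trans (×-congʳ (k C j) fj≈0) (trans (×-zero (k C j)) (sym (×-zero d)))

module SeriesAlgebra {ℓ} (R : CommutativeRing ℓ ℓ) (X : Set ℓ) where
  open CommutativeRing R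
  open Series R X
  open import Algebra.Properties.Semiring.Mult semiring using (_×_; ×-comm-*)
  open import Algebra.Properties.CommutativeMonoid.Mult +-commutativeMonoid
    using (×-distrib-+)
  open import Algebra.Properties.Semiring.Sum semiring
    using (sum-syntax; sum-cong-≋; ∑-distrib-+; *-distribˡ-sum)
  open import Algebra.Properties.Group +-group using (∙-cancelʳ)
  open import Relation.Binary.Reasoning.Setoid setoid
  open BinomialSums semiring

  natMul≈× : ∀ k r → natMul k r ≈ k × r
  natMul≈× zero    r = refl
  natMul≈× (suc k) r = +-congˡ (natMul≈× k r)

  ≈×⇒≈natMul : ∀ k {x r} → x ≈ k × r → x ≈ natMul k r
  ≈×⇒≈natMul k {r = r} x≈k×r = trans x≈k×r (sym (natMul≈× k r))

  1ₛ : Ser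
  1ₛ []      = 1#
  1ₛ (_ ∷ _) = 0#

  infix 30 _⁺
  _⁺ : Ser → Ser
  (s ⁺) []      = 0#
  (s ⁺) (x ∷ v) = s (x ∷ v)

  infixr 25 _^_
  _^_ : Ser → ℕ → Ser
  s ^ zero  = 1ₛ
  s ^ suc k = s · s ^ k

  1ₛ-nonempty : ∀ {v} → v ≢ [] → 1ₛ v ≈ 0#
  1ₛ-nonempty {[]}    v≢[] = ⊥-elim (v≢[] ≡.refl)
  1ₛ-nonempty {_ ∷ _} _    = refl

  private
    shift : X → Ser → Ser
    shift x s v = s (x ∷ v)

  ·-cons : ∀ s t x w → (s · t) (x ∷ w) ≈ s [] * t (x ∷ w) + (shift x s · t) w
  ·-cons s t x w = +-congˡ (reflexive (≡.cong sumR (≡.sym (map-∘ (splits w)))))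

  ·-congʳ : ∀ s {t t'} → t ≈ₛ t' → (s · t) ≈ₛ (s · t')
  ·-congʳ s {t} {t'} t≈t' w = sum-congᴸ (splits w)
    where
    sum-congᴸ : ∀ ps → sumR (map (λ p → s (proj₁ p) * t (proj₂ p)) ps) ≈
                       sumR (map (λ p → s (proj₁ p) * t' (proj₂ p)) ps)
    sum-congᴸ []       = refl
    sum-congᴸ (p ∷ ps) = +-cong (*-congˡ (t≈t' (proj₂ p))) (sum-congᴸ ps)

  ·-vanishes : ∀ s t w → (∀ a b → a ++ b ≡ w → s a * t b ≈ 0#) → (s · t) w ≈ 0#
  ·-vanishes s t []      st≈0 = trans (+-identityʳ _) (st≈0 [] [] ≡.refl)
  ·-vanishes s t (x ∷ w) st≈0 = begin
    (s · t) (x ∷ w)                      ≈⟨ ·-cons s t x w ⟩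
    s [] * t (x ∷ w) + (shift x s · t) w ≈⟨ +-cong (st≈0 [] (x ∷ w) ≡.refl)
                                                   (·-vanishes (shift x s) t w λ a b e →
                                                      st≈0 (x ∷ a) b (≡.cong (x ∷_) e)) ⟩
    0# + 0#                              ≈⟨ +-identityʳ 0# ⟩
    0#                                   ∎

  ·-last-split : ∀ s t w → (∀ a b → a ++ b ≡ w → b ≢ [] → s a * t b ≈ 0#) →
                 (s · t) w ≈ s w * t []
  ·-last-split s t []      _    = +-identityʳ _
  ·-last-split s t (x ∷ w) st≈0 = begin
    (s · t) (x ∷ w)                      ≈⟨ ·-cons s t x w ⟩
    s [] * t (x ∷ w) + (shift x s · t) w ≈⟨ +-cong (st≈0 [] (x ∷ w) ≡.refl λ ())
                                                   (·-last-split (shift x s) t w λ a b e →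
                                                      st≈0 (x ∷ a) b (≡.cong (x ∷_) e)) ⟩
    0# + s (x ∷ w) * t []                ≈⟨ +-identityˡ _ ⟩
    s (x ∷ w) * t []                     ∎

  ·-outer-splits : ∀ s t w → w ≢ [] →
    (∀ a b → a ++ b ≡ w → a ≢ [] → b ≢ [] → s a * t b ≈ 0#) →
    (s · t) w ≈ s [] * t w + s w * t []
  ·-outer-splits s t []      w≢[] _    = ⊥-elim (w≢[] ≡.refl)
  ·-outer-splits s t (x ∷ w) _    st≈0 = trans (·-cons s t x w) (+-congˡ (·-last-split (shift x s) t w
    λ a b e b≢[] → st≈0 (x ∷ a) b (≡.cong (x ∷_) e) (λ ()) b≢[]))

  ·-identityʳ : ∀ s → (s · 1ₛ) ≈ₛ s
  ·-identityʳ s w =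
    trans (·-last-split s 1ₛ w λ _ _ _ b≢[] → trans (*-congˡ (1ₛ-nonempty b≢[])) (zeroʳ _))
          (*-identityʳ _)

  t·p≈p+t⁺·p : ∀ t p → t [] ≈ 1# → ∀ w → (t · p) w ≈ p w + (t ⁺ · p) w
  t·p≈p+t⁺·p t p t[]≈1 []      = +-cong (trans (*-congʳ t[]≈1) (*-identityˡ _))
                                        (sym (trans (+-identityʳ _) (zeroˡ _)))
  t·p≈p+t⁺·p t p t[]≈1 (x ∷ w) = begin
    (t · p) (x ∷ w)                                   ≈⟨ ·-cons t p x w ⟩
    t [] * p (x ∷ w) + (shift x t · p) w              ≈⟨ +-congʳ (trans (*-congʳ t[]≈1) (*-identityˡ _)) ⟩
    p (x ∷ w) + (shift x t · p) w                     ≈⟨ +-congˡ (sym (+-identityˡ _)) ⟩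
    p (x ∷ w) + (0# + (shift x t · p) w)              ≈⟨ +-congˡ (+-congʳ (sym (zeroˡ _))) ⟩
    p (x ∷ w) + (0# * p (x ∷ w) + (shift x t · p) w)  ≈⟨ +-congˡ (sym (·-cons (t ⁺) p x w)) ⟩
    p (x ∷ w) + (t ⁺ · p) (x ∷ w)                     ∎

  ·-distrib-∑× : ∀ s {N} (c : Fin N → ℕ) (g : Fin N → Ser) w →
    (s · (λ u → ∑[ j < N ] (c j × g j u))) w ≈ ∑[ j < N ] (c j × (s · g j) w)
  ·-distrib-∑× s {N} c g w = over (splits w)
    where
    over : ∀ ps → sumR (map (λ p → s (proj₁ p) * ∑[ j < N ] (c j × g j (proj₂ p))) ps) ≈
                  ∑[ j < N ] (c j × sumR (map (λ p → s (proj₁ p) * g j (proj₂ p)) ps))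
    over []       = sym (∑-vanishes _ λ j → ×-zero (c j))
    over (p ∷ ps) = begin
      a * ∑[ j < N ] (c j × g j b) + _
        ≈⟨ +-cong (*-distribˡ-sum a (λ j → c j × g j b)) (over ps) ⟩
      ∑[ j < N ] (a * (c j × g j b)) + ∑[ j < N ] (c j × rest j)
        ≈⟨ +-congʳ (sum-cong-≋ λ j → ×-comm-* (c j) a (g j b)) ⟩
      ∑[ j < N ] (c j × (a * g j b)) + ∑[ j < N ] (c j × rest j)
        ≈⟨ sym (∑-distrib-+ (λ j → c j × (a * g j b)) (λ j → c j × rest j)) ⟩
      ∑[ j < N ] (c j × (a * g j b) + c j × rest j)
        ≈⟨ sum-cong-≋ (λ j → sym (×-distrib-+ (a * g j b) (rest j) (c j))) ⟩
      ∑[ j < N ] (c j × (a * g j b + rest j)) ∎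
      where
      a : Carrier
      a = s (proj₁ p)
      b : List X
      b = proj₂ p
      rest : Fin N → Carrier
      rest j = sumR (map (λ p → s (proj₁ p) * g j (proj₂ p)) ps)

  ^-binomial : ∀ t → t [] ≈ 1# → ∀ k w → (t ^ k) w ≈ binomialSum k (λ j → (t ⁺ ^ j) w)
  ^-binomial t t[]≈1 zero    w = sym (trans (+-identityʳ _) (+-identityʳ _))
  ^-binomial t t[]≈1 (suc k) w = begin
    (t · t ^ k) w
      ≈⟨ t·p≈p+t⁺·p t (t ^ k) t[]≈1 w ⟩
    (t ^ k) w + (t ⁺ · t ^ k) w
      ≈⟨ +-cong (^-binomial t t[]≈1 k w) (·-congʳ (t ⁺) (^-binomial t t[]≈1 k) w) ⟩
    B k (λ j → (t ⁺ ^ j) w) + (t ⁺ · (λ u → B k (λ j → (t ⁺ ^ j) u))) w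
      ≈⟨ +-congˡ (·-distrib-∑× (t ⁺) {suc k} (λ j → k C toℕ j) (λ j → t ⁺ ^ toℕ j) w) ⟩
    B k (λ j → (t ⁺ ^ j) w) + B k (λ j → (t ⁺ ^ suc j) w)
      ≈⟨ sym (binomialSum-pascal k (λ j → (t ⁺ ^ j) w)) ⟩
    B (suc k) (λ j → (t ⁺ ^ j) w) ∎
    where
    B : ℕ → (ℕ → Carrier) → Carrier
    B = binomialSum

  idempotent⇒1ₛ : ∀ e → e [] ≈ 1# → (∀ w → e w ≈ (e · e) w) → e ≈ₛ 1ₛ
  idempotent⇒1ₛ e e[]≈1 e≈e·e []      = e[]≈1
  idempotent⇒1ₛ e e[]≈1 e≈e·e (x ∷ w) = vanishes (suc (length (x ∷ w))) (x ∷ w) (ℕ.n<1+n _) (λ ())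
    where
    vanishes : ∀ N w → length w < N → w ≢ [] → e w ≈ 0#
    vanishes (suc N) w (s≤s |w|≤N) w≢[] = ∙-cancelʳ (e w) (e w) 0# (begin
      e w + e w                     ≈⟨ sym (+-cong (trans (*-congʳ e[]≈1) (*-identityˡ _))
                                                   (trans (*-congˡ e[]≈1) (*-identityʳ _))) ⟩
      e [] * e w + e w * e []       ≈⟨ sym (·-outer-splits e e w w≢[] middle) ⟩
      (e · e) w                     ≈⟨ sym (e≈e·e w) ⟩
      e w                           ≈⟨ sym (+-identityˡ _) ⟩
      0# + e w                      ∎)
      where
      middle : ∀ a b → a ++ b ≡ w → a ≢ [] → b ≢ [] → e a * e b ≈ 0#
      middle a []      _ _    b≢[] = ⊥-elim (b≢[] ≡.refl)
      middle a (y ∷ b) ≡.refl a≢[] _ = trans (*-congʳ (vanishes N a |a|<N a≢[]) ) (zeroˡ _)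
        where
        |a|<N : length a < N
        |a|<N = ℕ.<-≤-trans (≡.subst (length a <_) (≡.sym (length-++ a)) (ℕ.m<m+n (length a) ℕ.z<s))
                            |w|≤N

  ^-vanishes-short : ∀ {s m} → (∀ a → length a < m → s a ≈ 0#) →
                     ∀ j w → length w < j ℕ.* m → (s ^ j) w ≈ 0#
  ^-vanishes-short {s} {m} s≈0 (suc j) w |w|<[1+j]m = ·-vanishes s (s ^ j) w split
    where
    split : ∀ a b → a ++ b ≡ w → s a * (s ^ j) b ≈ 0#
    split a b ≡.refl with length a ℕ.<? m
    ... | yes |a|<m = trans (*-congʳ (s≈0 a |a|<m)) (zeroˡ _)
    ... | no  |a|≮m = trans (*-congˡ (^-vanishes-short s≈0 j b |b|<jm)) (zeroʳ _)
      where
      |b|<jm : length b < j ℕ.* m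
      |b|<jm = ℕ.+-cancelˡ-< m _ _ (ℕ.≤-<-trans (ℕ.+-monoˡ-≤ (length b) (ℕ.≮⇒≥ |a|≮m))
                                                 (≡.subst (_< m ℕ.+ j ℕ.* m) (length-++ a) |w|<[1+j]m))

  ^-vanishes-on : ∀ {p} {P : X → Set p} {s} → (∀ a → Any P a → s a ≈ 0#) →
                  ∀ j w → Any P w → (s ^ j) w ≈ 0#
  ^-vanishes-on s≈0 zero    (_ ∷ _) _   = refl
  ^-vanishes-on {s = s} s≈0 (suc j) w Pw = ·-vanishes s (s ^ j) w split
    where
    split : ∀ a b → a ++ b ≡ w → s a * (s ^ j) b ≈ 0#
    split a b ≡.refl with ++⁻ a Pw
    ... | inj₁ Pa = trans (*-congʳ (s≈0 a Pa)) (zeroˡ _)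
    ... | inj₂ Pb = trans (*-congˡ (^-vanishes-on s≈0 j b Pb)) (zeroʳ _)

module MagnusFormationProperties
  {ℓ n} {X : Set ℓ} {_<ₓ_ : X → X → Set ℓ} (<ₓ-sto : IsStrictTotalOrder _≡_ _<ₓ_)
  {R : CommutativeRing ℓ ℓ} {TR : Topology (CommutativeRing.Carrier R)}
  {G : Group ℓ ℓ} {TG : Topology (Group.Carrier G)}
  (Φ : MagnusFormation n X _<ₓ_ R TR G TG) where
  open MagnusFormation Φ
  open CommutativeRing R
  open Series R X
  open SeriesAlgebra R X
  open BinomialSums semiring
  open import Algebra.Properties.Semiring.Mult semiring using (_×_; ×-congʳ)
  open Words _<ₓ_
  open LengthAlphabetical <ₓ-sto
  open GPow G
  private module G = Group G

  Λ-ε : Λ G.ε ≈ₛ 1ₛ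
  Λ-ε = idempotent⇒1ₛ (Λ G.ε) (Λ-const G.ε)
          (λ w → trans (Λ-resp (G.sym (G.identityˡ G.ε)) w) (Λ-hom G.ε G.ε w))

  Λ-gpow : ∀ g k → Λ (gpow g k) ≈ₛ Λ g ^ k
  Λ-gpow g zero    = Λ-ε
  Λ-gpow g (suc k) w = trans (Λ-hom g (gpow g k) w) (·-congʳ (Λ g) (Λ-gpow g k) w)

  module _ (w' : List X) (p : L w') where
    private
      T : Ser
      T = Λ (τ w' p)

      m : ℕ
      m = length w'

    w'≢[] : w' ≢ []
    w'≢[] w'≡[] with ≡.subst (λ v → 1 ≤ length v) w'≡[] (proj₁ (L-len w' p))
    ... | ()

    T⁺-short : ∀ a → length a < m → (T ⁺) a ≈ 0#
    T⁺-short []      _     = refl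
    T⁺-short (x ∷ a) |a|<m = τ-rest w' p (x ∷ a) (λ ())
      (λ a≡w' → ℕ.<-irrefl (≡.cong length a≡w') |a|<m)
      (λ (w'≺a , _) → ℕ.<⇒≱ |a|<m (≺⇒length≤ w'≺a))

    T-foreign : ∀ a → Any (_∉ w') a → T a ≈ 0#
    T-foreign a foreign = τ-rest w' p a (λ { ≡.refl → foreign-nonempty foreign })
      (λ { ≡.refl → Any¬⇒¬All foreign (All.tabulate id) })
      (λ (_ , a⊆w') → Any¬⇒¬All foreign a⊆w')
      where
      foreign-nonempty : Any (_∉ w') [] → ⊥
      foreign-nonempty ()

    εσ-expansion : ∀ w → εcoef Φ w (σ Φ w' p) ≈ binomialSum (e m) (λ j → (T ⁺ ^ j) w)
    εσ-expansion w = trans (Λ-gpow (τ w' p) (e m) w) (^-binomial T (τ-const w' p) (e m) w)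

    εσ-short : ∀ w → w ≢ [] → length w ≤ m → εcoef Φ w (σ Φ w' p) ≈ e m × T w
    εσ-short w@(_ ∷ _) w≢[] |w|≤m = trans (εσ-expansion w)
      (trans (binomialSum-at-1 (e m) (λ j → (T ⁺ ^ j) w) refl λ j →
                ^-vanishes-short T⁺-short (2 ℕ.+ j) w (ℕ.≤-<-trans |w|≤m (m<[2+j]m j)))
             (×-congʳ (e m) (·-identityʳ (T ⁺) w)))
      where
      m<[2+j]m : ∀ j → m < (2 ℕ.+ j) ℕ.* m
      m<[2+j]m j = ℕ.m<m+n m (ℕ.<-≤-trans (proj₁ (L-len w' p)) (ℕ.m≤m+n m _))
    εσ-short [] w≢[] _ = ⊥-elim (w≢[] ≡.refl)

    εσ-below : ∀ w → w ≢ [] → w ≺ w' → εcoef Φ w (σ Φ w' p) ≈ 0#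
    εσ-below w w≢[] w≺w' = trans (εσ-short w w≢[] (≺⇒length≤ w≺w'))
      (trans (×-congʳ (e m) (τ-rest w' p w w≢[] (λ { ≡.refl → ≺-irrefl w≺w' })
                                                 (λ (w'≺w , _) → ≺-asym w≺w' w'≺w)))
             (×-zero (e m)))

    εσ-diagonal : εcoef Φ w' (σ Φ w' p) ≈ e m × 1#
    εσ-diagonal = trans (εσ-short w' w'≢[] ℕ.≤-refl) (×-congʳ (e m) (τ-lead w' p))

    εσ-multiple : ∀ w → 1 ≤ length w → length w ≤ n →
                  Σ Carrier λ r → εcoef Φ w (σ Φ w' p) ≈ e (length w) × r
    εσ-multiple w 1≤|w| |w|≤n =
      map₂ (trans (εσ-expansion w))
           (binomialSum-multiple (e (length w)) (e m) (λ j → (T ⁺ ^ j) w) term)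
      where
      term : ∀ j → j ≤ e m → e (length w) ∣ e m C j ⊎ (T ⁺ ^ j) w ≈ 0#
      term zero    _ = inj₂ (1ₛ-nonempty {w} λ { ≡.refl → ℕ.<-irrefl ≡.refl 1≤|w| })
      term (suc j) j<e with suc j ℕ.* m ℕ.≤? length w
      ... | yes [1+j]m≤|w| = inj₁ (e-binomial (length w) m (suc j) (proj₁ (L-len w' p))
                                     (≡.subst (_≤ length w) (ℕ.*-comm (suc j) m) [1+j]m≤|w|)
                                     |w|≤n (s≤s z≤n) j<e)
      ... | no  [1+j]m≰|w| = inj₂ (^-vanishes-short T⁺-short (suc j) w (ℕ.≰⇒> [1+j]m≰|w|))

    εσ-foreign : ∀ w → Any (_∉ w') w → εcoef Φ w (σ Φ w' p) ≈ 0#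
    εσ-foreign w foreign = trans (Λ-gpow (τ w' p) (e m) w) (^-vanishes-on T-foreign (e m) w foreign)

-- Imported only here: in the modules above, _×_ is the action of ℕ on a semiring.
open import Data.Product using (_×_)

proposition5p1 : {ℓ : Level} (n : ℕ) → 2 ≤ n →
    (X : Set ℓ) (_<ₓ_ : X → X → Set ℓ) → IsStrictTotalOrder _≡_ _<ₓ_ →
    (R : CommutativeRing ℓ ℓ) (TR : Topology (CommutativeRing.Carrier R)) →
    IsProfiniteRing R TR →
    (G : Group ℓ ℓ) (TG : Topology (Group.Carrier G)) → IsProfiniteGroup G TG →
    (Φ : MagnusFormation n X _<ₓ_ R TR G TG) →
    (w w' : List X) (p : MagnusFormation.L Φ w') →
      ((¬ (w ≡ []) → Words._≺_ _<ₓ_ w w' →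
          CommutativeRing._≈_ R (εcoef Φ w (σ Φ w' p)) (CommutativeRing.0# R))
      × (w ≡ w' →
          CommutativeRing._≈_ R (εcoef Φ w (σ Φ w' p))
            (Series.natMul R X (MagnusFormation.e Φ (length w)) (CommutativeRing.1# R)))
      × (1 ≤ length w → length w ≤ n →
          Σ (CommutativeRing.Carrier R) (λ r →
            CommutativeRing._≈_ R (εcoef Φ w (σ Φ w' p))
              (Series.natMul R X (MagnusFormation.e Φ (length w)) r)))
      × (Any (λ x → x ∉ w') w →
          CommutativeRing._≈_ R (εcoef Φ w (σ Φ w' p)) (CommutativeRing.0# R)))
proposition5p1 n _ X _<ₓ_ <ₓ-sto R _ _ G _ _ Φ w w' p =
    εσ-below w' p w
  , (λ { ≡.refl → ≈×⇒≈natMul (e (length w')) (εσ-diagonal w' p) })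
  , (λ 1≤|w| |w|≤n → map₂ (≈×⇒≈natMul (e (length w))) (εσ-multiple w' p w 1≤|w| |w|≤n))
  , εσ-foreign w' p w
  where
  open MagnusFormationProperties <ₓ-sto Φ
  open SeriesAlgebra R X using (≈×⇒≈natMul)
  open MagnusFormation Φ using (e)
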